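{- Let $d\in\mathbb{N}^{\ast}$ and $l_1,\ldots,l_d\in\mathbb{N}^{\ast}$. Then the function $N\mapsto \tilde{H}_N(-l_d,\ldots,-l_1)$, $N\in\mathbb{N}^{\ast}$, is a polynomial function of $N$ with rational coefficients, of degree at most $l_d+\cdots+l_1+d$ and with zero constant coefficient. Moreover, for $1\le k_d\le l_1+\cdots+l_d+d$, the coefficient of $N^{k_d}$ in this polynomial is $$\mathbb{B}^{l_d,\ldots,l_1}_{k_d}=\sum_{k_1=1}^{l_1+1}\ \sum_{k_2=1}^{k_1+l_2+1}\cdots\sum_{k_{d-1}=1}^{k_{d-2}+l_{d-1}+1}\mathbb{B}^{l_1}_{k_1}\,\mathbb{B}^{k_1+l_2}_{k_2}\cdots\mathbb{B}^{k_{d-1}+l_d}_{k_d}.$$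
   Context: For $N\in\mathbb{N}^{\ast}$ and $l_1,\ldots,l_d\in\mathbb{N}$, $\tilde{H}_N(-l_d,\ldots,-l_1)=\sum_{0\le n_1<n_2<\cdots<n_d<N} n_1^{l_1}\cdots n_d^{l_d}$ (with the convention $0^0=1$). For $l\in\mathbb{N}$ and $u\in\mathbb{N}^{\ast}$, $\mathbb{B}^{l}_{u}=\frac{1}{l+1}\binom{l+1}{u}B_{l+1-u}$ (which is $0$ when $u>l+1$), where $B_n$ are the Bernoulli numbers with $B_0=1$, $B_1=-1/2$. -}

module Defs where

open import Data.Nat as ℕ using (ℕ; zero; suc)
open import Data.Nat.Combinatorics using (_C_)
open import Data.Integer using (+_)
open import Data.Rational using (ℚ; 0ℚ; 1ℚ; _+_; _*_; -_; _/_)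
open import Data.List using (List; []; _∷_; _++_; [_]; lookup; length)
open import Data.Vec using (Vec; []; _∷_)
open import Data.Bool using (if_then_else_)

⟦_⟧ : ℕ → ℚ
⟦ n ⟧ = (+ n) / 1

_^ℚ_ : ℚ → ℕ → ℚ
p ^ℚ zero = 1ℚ
p ^ℚ suc n = p * (p ^ℚ n)

-- Σ_{i=a}^{b} f i  (empty if b < a)
Σ[_⋯_] : ℕ → ℕ → (ℕ → ℚ) → ℚ
Σ[ a ⋯ b ] f = go a (suc b ℕ.∸ a)
  where
  go : ℕ → ℕ → ℚ
  go i zero = 0ℚ
  go i (suc k) = f i + go (suc i) k

sumIdx : List ℚ → (ℕ → ℚ → ℚ) → ℚ
sumIdx xs f = go 0 xs
  where
  go : ℕ → List ℚ → ℚ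
  go j [] = 0ℚ
  go j (x ∷ xs) = f j x + go (suc j) xs

-- Bernoulli numbers B_0 … B_n (B_1 = -1/2), via
-- B_m = -(1/(m+1)) Σ_{j=0}^{m-1} C(m+1, j) B_j
bernoulliList : ℕ → List ℚ
bernoulliList zero = [ 1ℚ ]
bernoulliList (suc n) =
  bernoulliList n ++
  [ - (((+ 1) / (suc (suc n))) * sumIdx (bernoulliList n) (λ j b → ⟦ suc (suc n) C j ⟧ * b)) ]

nth : List ℚ → ℕ → ℚ
nth [] _ = 0ℚ
nth (x ∷ xs) zero = x
nth (x ∷ xs) (suc n) = nth xs n

bernoulli : ℕ → ℚ
bernoulli n = nth (bernoulliList n) n

𝔹 : ℕ → ℕ → ℚ
𝔹 l u = if (suc l) ℕ.<ᵇ u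
        then 0ℚ
        else ((+ 1) / suc l) * (⟦ suc l C u ⟧ * bernoulli (suc l ℕ.∸ u))

ΣℕRange : ℕ → ℕ → (ℕ → ℕ) → ℕ
ΣℕRange m N f = go m (N ℕ.∸ m)
  where
  go : ℕ → ℕ → ℕ
  go i zero = 0
  go i (suc k) = f i ℕ.+ go (suc i) k

-- Hfrom m N (l_1,…,l_d) = Σ_{m ≤ n_1 < n_2 < … < n_d < N} n_1^{l_1} ⋯ n_d^{l_d}   (0^0 = 1)
Hfrom : ∀ {d} → ℕ → ℕ → Vec ℕ d → ℕ
Hfrom m N [] = 1
Hfrom m N (l ∷ ls) = ΣℕRange m N (λ n → (n ℕ.^ l) ℕ.* Hfrom (suc n) N ls)

-- H̃_N(-l_d,…,-l_1) with ls = (l_1, …, l_d):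
-- Σ_{0 ≤ n_1 < … < n_d < N} n_1^{l_1} ⋯ n_d^{l_d}
Htilde : ∀ {d} → ℕ → Vec ℕ d → ℕ
Htilde N ls = Hfrom 0 N ls

nestedCoef : ∀ {d} → ℕ → Vec ℕ d → ℕ → ℚ
nestedCoef kp [] kd = 0ℚ
nestedCoef kp (l ∷ []) kd = 𝔹 (kp ℕ.+ l) kd
nestedCoef kp (l ∷ l' ∷ ls) kd =
  Σ[ 1 ⋯ kp ℕ.+ l ℕ.+ 1 ] (λ k → 𝔹 (kp ℕ.+ l) k * nestedCoef k (l' ∷ ls) kd)

-- 𝔹^{l_d,…,l_1}_{k_d} with ls = (l_1, …, l_d); the outermost sum runs k_1 = 1 … l_1 + 1
𝔹multi : ∀ {d} → Vec ℕ d → ℕ → ℚ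
𝔹multi ls kd = nestedCoef 0 ls kd

{-# OPTIONS --safe #-}
-- The polynomial P_l(x) = Σ_{k=1}^{l+1} 𝔹^l_k x^k satisfies P_l(x + 1) − P_l(x) = x^l: comparing
-- coefficients via the binomial theorem, this is the Bernoulli recurrence Σ_{j<m} C(m,j) B_j = [m = 1].
-- Hence Σ_{n<N} n^l = P_l(N) (Faulhaber). In H̃_N the innermost sum Σ_{n_1<n_2} n_1^{l_1} is thus
-- Σ_k 𝔹^{l_1}_k n_2^k, and n_2^k · n_2^{l_2} turns H̃_N into a combination of sums of depth d − 1
-- with first exponent k + l_2; induction on the depth produces exactly the nested coefficients.
module Submission where

open import Defs
open import Data.Nat as ℕ using (ℕ; zero; suc; _∸_; _≤_; _<_; s≤s; _!)
import Data.Nat.Properties as ℕₚ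
open import Data.Nat.Combinatorics
  using (_C_; nCk≡n!/k![n-k]!; k![n∸k]!∣n!; nCk≡nC[n∸k]; nC1≡n; nCn≡1; k>n⇒nCk≡0; nCk+nC[k+1]≡[n+1]C[k+1])
open import Data.Nat.DivMod using (m/n*n≡m)
open import Data.Nat.Coprimality as Coprime using (Coprime; 1-coprimeTo)
import Data.Nat.Solver as ℕSolver
import Data.Integer as ℤ
import Data.Integer.Properties as ℤₚ
open import Data.Rational using (ℚ; 0ℚ; 1ℚ; _+_; _*_; -_; _/_; mkℚ)
import Data.Rational.Properties as ℚₚ
open import Data.Rational.Solver using (module +-*-Solver)
open import Data.Bool using (true; false; T)
open import Data.Unit using (tt)
open import Data.Empty using (⊥-elim)
open import Data.List using (List; []; _∷_; _++_; [_]; length)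
import Data.List.Properties as Listₚ
open import Data.Vec using (Vec; []; _∷_; sum)
open import Data.Vec.Relation.Unary.All using (All)
open import Relation.Nullary using (yes; no)
open import Relation.Binary.PropositionalEquality hiding ([_])
open import Function using (_∘_)

open +-*-Solver using (solve; _:+_; _:*_; _:=_; con; :-_)
open ℕSolver.+-*-Solver using () renaming (solve to solveℕ; _:+_ to _⊕_; _:*_ to _⊛_; _:=_ to _⊜_; con to conℕ)

coprime-1 : ∀ n → Coprime n 1
coprime-1 n = Coprime.sym (1-coprimeTo n)

⟦⟧≡mkℚ : ∀ n → ⟦ n ⟧ ≡ mkℚ (ℤ.+ n) 0 (coprime-1 n)
⟦⟧≡mkℚ n = ℚₚ.normalize-coprime (coprime-1 n)

⟦⟧-homo-+ : ∀ m n → ⟦ m ℕ.+ n ⟧ ≡ ⟦ m ⟧ + ⟦ n ⟧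
⟦⟧-homo-+ m n rewrite ⟦⟧≡mkℚ m | ⟦⟧≡mkℚ n
  | ℕₚ.*-identityʳ m | ℕₚ.*-identityʳ n | ℤₚ.+◃n≡+n m | ℤₚ.+◃n≡+n n = refl

⟦⟧-homo-* : ∀ m n → ⟦ m ℕ.* n ⟧ ≡ ⟦ m ⟧ * ⟦ n ⟧
⟦⟧-homo-* m n rewrite ⟦⟧≡mkℚ m | ⟦⟧≡mkℚ n | ℤₚ.+◃n≡+n (m ℕ.* n) = refl

⟦⟧-homo-^ : ∀ n k → ⟦ n ℕ.^ k ⟧ ≡ ⟦ n ⟧ ^ℚ k
⟦⟧-homo-^ n zero = refl
⟦⟧-homo-^ n (suc k) rewrite ⟦⟧-homo-* n (n ℕ.^ k) | ⟦⟧-homo-^ n k = refl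

⟦1+n⟧*1/[1+n]≡1 : ∀ n → ⟦ suc n ⟧ * (ℤ.+ 1 / suc n) ≡ 1ℚ
⟦1+n⟧*1/[1+n]≡1 n =
  trans (cong₂ _*_ (⟦⟧≡mkℚ (suc n)) (ℚₚ.normalize-coprime (1-coprimeTo (suc n))))
        (ℚₚ.*-inverseʳ (mkℚ (ℤ.+ suc n) 0 (coprime-1 (suc n))))

^ℚ-distribˡ-+-* : ∀ x m n → x ^ℚ (m ℕ.+ n) ≡ x ^ℚ m * x ^ℚ n
^ℚ-distribˡ-+-* x zero n = sym (ℚₚ.*-identityˡ _)
^ℚ-distribˡ-+-* x (suc m) n rewrite ^ℚ-distribˡ-+-* x m n = sym (ℚₚ.*-assoc x (x ^ℚ m) (x ^ℚ n))

∑ : ℕ → (ℕ → ℚ) → ℚ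
∑ zero f = 0ℚ
∑ (suc n) f = ∑ n f + f n

syntax ∑ n (λ i → e) = ∑[ i < n ] e

∑-cong : ∀ n {f g : ℕ → ℚ} → (∀ i → i < n → f i ≡ g i) → ∑ n f ≡ ∑ n g
∑-cong zero eq = refl
∑-cong (suc n) eq = cong₂ _+_ (∑-cong n (λ i i<n → eq i (ℕₚ.m<n⇒m<1+n i<n))) (eq n ℕₚ.≤-refl)

∑-cong′ : ∀ n {f g : ℕ → ℚ} → (∀ i → f i ≡ g i) → ∑ n f ≡ ∑ n g
∑-cong′ n eq = ∑-cong n (λ i _ → eq i)

∑≡0 : ∀ n {f : ℕ → ℚ} → (∀ i → i < n → f i ≡ 0ℚ) → ∑ n f ≡ 0ℚ
∑≡0 zero eq = refl
∑≡0 (suc n) eq rewrite ∑≡0 n (λ i i<n → eq i (ℕₚ.m<n⇒m<1+n i<n)) | eq n ℕₚ.≤-refl = refl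

∑-distrib-+ : ∀ n (f g : ℕ → ℚ) → ∑[ i < n ] (f i + g i) ≡ ∑ n f + ∑ n g
∑-distrib-+ zero f g = refl
∑-distrib-+ (suc n) f g rewrite ∑-distrib-+ n f g =
  solve 4 (λ a b c d → (a :+ b) :+ (c :+ d) := (a :+ c) :+ (b :+ d)) refl (∑ n f) (∑ n g) (f n) (g n)

*-distribˡ-∑ : ∀ n c (f : ℕ → ℚ) → c * ∑ n f ≡ ∑[ i < n ] (c * f i)
*-distribˡ-∑ zero c f = ℚₚ.*-zeroʳ c
*-distribˡ-∑ (suc n) c f rewrite sym (*-distribˡ-∑ n c f) = ℚₚ.*-distribˡ-+ c (∑ n f) (f n)

*-distribʳ-∑ : ∀ n c (f : ℕ → ℚ) → ∑ n f * c ≡ ∑[ i < n ] (f i * c)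
*-distribʳ-∑ zero c f = ℚₚ.*-zeroˡ c
*-distribʳ-∑ (suc n) c f rewrite sym (*-distribʳ-∑ n c f) = ℚₚ.*-distribʳ-+ c (∑ n f) (f n)

∑-comm : ∀ n m (f : ℕ → ℕ → ℚ) → ∑[ i < n ] ∑[ j < m ] f i j ≡ ∑[ j < m ] ∑[ i < n ] f i j
∑-comm zero m f = sym (∑≡0 m (λ _ _ → refl))
∑-comm (suc n) m f rewrite ∑-comm n m f = sym (∑-distrib-+ m (λ j → ∑[ i < n ] f i j) (f n))

∑-suc : ∀ n (f : ℕ → ℚ) → ∑ (suc n) f ≡ f 0 + ∑[ i < n ] f (suc i)
∑-suc zero f = trans (ℚₚ.+-identityˡ (f 0)) (sym (ℚₚ.+-identityʳ (f 0)))
∑-suc (suc n) f rewrite ∑-suc n f = ℚₚ.+-assoc (f 0) (∑[ i < n ] f (suc i)) (f (suc n))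

∑-split : ∀ m n (f : ℕ → ℚ) → ∑ (m ℕ.+ n) f ≡ ∑ m f + ∑[ i < n ] f (m ℕ.+ i)
∑-split m zero f rewrite ℕₚ.+-identityʳ m = sym (ℚₚ.+-identityʳ (∑ m f))
∑-split m (suc n) f rewrite ℕₚ.+-suc m n | ∑-split m n f =
  ℚₚ.+-assoc (∑ m f) (∑[ i < n ] f (m ℕ.+ i)) (f (m ℕ.+ n))

∑-extend : ∀ n R (f : ℕ → ℚ) → n ≤ R → (∀ i → n ≤ i → f i ≡ 0ℚ) → ∑ R f ≡ ∑ n f
∑-extend n R f n≤R vanish = begin
  ∑ R f                                   ≡⟨ cong (λ k → ∑ k f) (sym (ℕₚ.m+[n∸m]≡n n≤R)) ⟩
  ∑ (n ℕ.+ (R ∸ n)) f                     ≡⟨ ∑-split n (R ∸ n) f ⟩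
  ∑ n f + ∑[ i < R ∸ n ] f (n ℕ.+ i)      ≡⟨ cong (∑ n f +_) (∑≡0 (R ∸ n) (λ i _ → vanish (n ℕ.+ i) (ℕₚ.m≤m+n n i))) ⟩
  ∑ n f + 0ℚ                              ≡⟨ ℚₚ.+-identityʳ (∑ n f) ⟩
  ∑ n f                                   ∎
  where open ≡-Reasoning

∑-reverse : ∀ n (f : ℕ → ℚ) → ∑ n f ≡ ∑[ i < n ] f (n ∸ suc i)
∑-reverse zero f = refl
∑-reverse (suc n) f rewrite ∑-suc n (λ i → f (suc n ∸ suc i)) | sym (∑-reverse n f) =
  ℚₚ.+-comm (∑ n f) (f n)

δ : ℕ → ℕ → ℚ
δ i j with i ℕ.≟ j
... | yes _ = 1ℚ
... | no _ = 0ℚ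

δ-refl : ∀ i → δ i i ≡ 1ℚ
δ-refl i with i ℕ.≟ i
... | yes _ = refl
... | no i≢i = ⊥-elim (i≢i refl)

δ-≢ : ∀ {i j} → i ≢ j → δ i j ≡ 0ℚ
δ-≢ {i} {j} i≢j with i ℕ.≟ j
... | yes i≡j = ⊥-elim (i≢j i≡j)
... | no _ = refl

∑-δ : ∀ n l (g : ℕ → ℚ) → l < n → ∑[ i < n ] (δ i l * g i) ≡ g l
∑-δ (suc n) l g l<1+n with l ℕ.≟ n
... | yes refl = begin
  ∑[ i < l ] (δ i l * g i) + δ l l * g l
    ≡⟨ cong₂ _+_ (∑≡0 l (λ i i<l → trans (cong (_* g i) (δ-≢ (ℕₚ.<⇒≢ i<l))) (ℚₚ.*-zeroˡ (g i))))
                 (cong (_* g l) (δ-refl l)) ⟩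
  0ℚ + 1ℚ * g l ≡⟨ trans (ℚₚ.+-identityˡ _) (ℚₚ.*-identityˡ _) ⟩
  g l           ∎
  where open ≡-Reasoning
... | no l≢n = begin
  ∑[ i < n ] (δ i l * g i) + δ n l * g n
    ≡⟨ cong₂ _+_ (∑-δ n l g (ℕₚ.≤∧≢⇒< (ℕₚ.≤-pred l<1+n) l≢n))
                 (trans (cong (_* g n) (δ-≢ (l≢n ∘ sym))) (ℚₚ.*-zeroˡ (g n))) ⟩
  g l + 0ℚ ≡⟨ ℚₚ.+-identityʳ _ ⟩
  g l      ∎
  where open ≡-Reasoning

Σ[⋯]-step : ∀ a b (f : ℕ → ℚ) → a ≤ b → Σ[ a ⋯ b ] f ≡ f a + Σ[ suc a ⋯ b ] f
Σ[⋯]-step a b f a≤b rewrite ℕₚ.+-∸-assoc 1 a≤b = refl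

Σ[⋯]≡∑ : ∀ a b (f : ℕ → ℚ) → Σ[ a ⋯ b ] f ≡ ∑[ i < suc b ∸ a ] f (a ℕ.+ i)
Σ[⋯]≡∑ a b f = go (suc b ∸ a) a refl
  where
  go : ∀ k a → suc b ∸ a ≡ k → Σ[ a ⋯ b ] f ≡ ∑[ i < k ] f (a ℕ.+ i)
  go zero a len rewrite len = refl
  go (suc k) a len = begin
    Σ[ a ⋯ b ] f
      ≡⟨ Σ[⋯]-step a b f a≤b ⟩
    f a + Σ[ suc a ⋯ b ] f
      ≡⟨ cong₂ _+_ (cong f (sym (ℕₚ.+-identityʳ a))) (go k (suc a) len′) ⟩
    f (a ℕ.+ 0) + ∑[ i < k ] f (suc a ℕ.+ i)
      ≡⟨ cong (f (a ℕ.+ 0) +_) (∑-cong′ k (λ i → cong f (sym (ℕₚ.+-suc a i)))) ⟩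
    f (a ℕ.+ 0) + ∑[ i < k ] f (a ℕ.+ suc i)
      ≡⟨ sym (∑-suc k (λ i → f (a ℕ.+ i))) ⟩
    ∑[ i < suc k ] f (a ℕ.+ i) ∎
    where
    open ≡-Reasoning
    a≤b : a ≤ b
    a≤b = ℕₚ.≤-pred (ℕₚ.m∸n≢0⇒n<m (λ len≡0 → ℕₚ.1+n≢0 (trans (sym len) len≡0)))
    len′ : suc b ∸ suc a ≡ k
    len′ = ℕₚ.suc-injective (trans (sym (ℕₚ.+-∸-assoc 1 a≤b)) len)

∑range : ℕ → ℕ → (ℕ → ℚ) → ℚ
∑range m N f = ∑[ i < N ∸ m ] f (m ℕ.+ i)

∑range-snoc : ∀ m N f → m ≤ N → ∑range m (suc N) f ≡ ∑range m N f + f N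
∑range-snoc m N f m≤N rewrite ℕₚ.+-∸-assoc 1 m≤N | ℕₚ.m+[n∸m]≡n m≤N = refl

∑range-empty : ∀ N f → ∑range N N f ≡ 0ℚ
∑range-empty N f rewrite ℕₚ.n∸n≡0 N = refl

ΣℕRange-step : ∀ m N f → m < N → ΣℕRange m N f ≡ f m ℕ.+ ΣℕRange (suc m) N f
ΣℕRange-step m N f m<N rewrite ℕₚ.+-∸-assoc 1 m<N = refl

⟦ΣℕRange⟧ : ∀ m N f → ⟦ ΣℕRange m N f ⟧ ≡ ∑range m N (λ n → ⟦ f n ⟧)
⟦ΣℕRange⟧ m N f = go (N ∸ m) m refl
  where
  go : ∀ k m → N ∸ m ≡ k → ⟦ ΣℕRange m N f ⟧ ≡ ∑[ i < k ] ⟦ f (m ℕ.+ i) ⟧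
  go zero m len rewrite len = refl
  go (suc k) m len = begin
    ⟦ ΣℕRange m N f ⟧
      ≡⟨ cong ⟦_⟧ (ΣℕRange-step m N f m<N) ⟩
    ⟦ f m ℕ.+ ΣℕRange (suc m) N f ⟧
      ≡⟨ ⟦⟧-homo-+ (f m) _ ⟩
    ⟦ f m ⟧ + ⟦ ΣℕRange (suc m) N f ⟧
      ≡⟨ cong₂ _+_ (cong (⟦_⟧ ∘ f) (sym (ℕₚ.+-identityʳ m))) (go k (suc m) len′) ⟩
    ⟦ f (m ℕ.+ 0) ⟧ + ∑[ i < k ] ⟦ f (suc m ℕ.+ i) ⟧
      ≡⟨ cong (⟦ f (m ℕ.+ 0) ⟧ +_) (∑-cong′ k (λ i → cong (⟦_⟧ ∘ f) (sym (ℕₚ.+-suc m i)))) ⟩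
    ⟦ f (m ℕ.+ 0) ⟧ + ∑[ i < k ] ⟦ f (m ℕ.+ suc i) ⟧
      ≡⟨ sym (∑-suc k (λ i → ⟦ f (m ℕ.+ i) ⟧)) ⟩
    ∑[ i < suc k ] ⟦ f (m ℕ.+ i) ⟧ ∎
    where
    open ≡-Reasoning
    m<N : m < N
    m<N = ℕₚ.m∸n≢0⇒n<m (λ len≡0 → ℕₚ.1+n≢0 (trans (sym len) len≡0))
    len′ : N ∸ suc m ≡ k
    len′ = ℕₚ.suc-injective (trans (sym (ℕₚ.+-∸-assoc 1 m<N)) len)

-- `sumIdx` recurses through a local helper that cannot be referred to by name; the
-- meta `sumIdx-go` is solved to that helper by the with-abstraction in `sumIdx-∷`.
mutual
  sumIdx-go : List ℚ → (ℕ → ℚ → ℚ) → ℕ → List ℚ → ℚ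
  sumIdx-go = _

  sumIdx-∷ : ∀ x xs f → sumIdx (x ∷ xs) f ≡ f 0 x + sumIdx-go (x ∷ xs) f 1 xs
  sumIdx-∷ x xs f with x ∷ xs | 1
  ... | _ | _ = refl

sumIdx-go≡∑ : ∀ ys xs f j → sumIdx-go xs f j ys ≡ ∑[ t < length ys ] f (j ℕ.+ t) (nth ys t)
sumIdx-go≡∑ [] xs f j = refl
sumIdx-go≡∑ (y ∷ ys) xs f j = begin
  f j y + sumIdx-go xs f (suc j) ys
    ≡⟨ cong₂ _+_ (cong (λ i → f i y) (sym (ℕₚ.+-identityʳ j))) (sumIdx-go≡∑ ys xs f (suc j)) ⟩
  f (j ℕ.+ 0) y + ∑[ t < length ys ] f (suc j ℕ.+ t) (nth ys t)
    ≡⟨ cong (f (j ℕ.+ 0) y +_) (∑-cong′ (length ys) (λ t → cong (λ i → f i (nth ys t)) (sym (ℕₚ.+-suc j t)))) ⟩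
  f (j ℕ.+ 0) y + ∑[ t < length ys ] f (j ℕ.+ suc t) (nth ys t)
    ≡⟨ sym (∑-suc (length ys) (λ t → f (j ℕ.+ t) (nth (y ∷ ys) t))) ⟩
  ∑[ t < suc (length ys) ] f (j ℕ.+ t) (nth (y ∷ ys) t) ∎
  where open ≡-Reasoning

sumIdx≡∑ : ∀ xs f → sumIdx xs f ≡ ∑[ t < length xs ] f t (nth xs t)
sumIdx≡∑ [] f = refl
sumIdx≡∑ (x ∷ xs) f = begin
  sumIdx (x ∷ xs) f                                         ≡⟨ sumIdx-∷ x xs f ⟩
  f 0 x + sumIdx-go (x ∷ xs) f 1 xs                         ≡⟨ cong (f 0 x +_) (sumIdx-go≡∑ xs (x ∷ xs) f 1) ⟩
  f 0 x + ∑[ t < length xs ] f (suc t) (nth xs t)           ≡⟨ sym (∑-suc (length xs) (λ t → f t (nth (x ∷ xs) t))) ⟩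
  ∑[ t < length (x ∷ xs) ] f t (nth (x ∷ xs) t)             ∎
  where open ≡-Reasoning

nth-++ˡ : ∀ xs ys j → j < length xs → nth (xs ++ ys) j ≡ nth xs j
nth-++ˡ (x ∷ xs) ys zero _ = refl
nth-++ˡ (x ∷ xs) ys (suc j) (s≤s j<n) = nth-++ˡ xs ys j j<n

nth-++-length : ∀ xs y → nth (xs ++ [ y ]) (length xs) ≡ y
nth-++-length [] y = refl
nth-++-length (x ∷ xs) y = nth-++-length xs y

length-bernoulliList : ∀ n → length (bernoulliList n) ≡ suc n
length-bernoulliList zero = refl
length-bernoulliList (suc n) =
  trans (Listₚ.length-++ (bernoulliList n))
        (trans (cong (ℕ._+ 1) (length-bernoulliList n)) (ℕₚ.+-comm (suc n) 1))

nth-bernoulliList : ∀ n j → j ≤ n → nth (bernoulliList n) j ≡ bernoulli j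
nth-bernoulliList n j j≤n rewrite sym (ℕₚ.m+[n∸m]≡n j≤n) = go (n ∸ j)
  where
  go : ∀ k → nth (bernoulliList (j ℕ.+ k)) j ≡ bernoulli j
  go zero rewrite ℕₚ.+-identityʳ j = refl
  go (suc k) rewrite ℕₚ.+-suc j k = trans
    (nth-++ˡ (bernoulliList (j ℕ.+ k)) _ j
      (subst (j <_) (sym (length-bernoulliList (j ℕ.+ k))) (s≤s (ℕₚ.m≤m+n j k))))
    (go k)

bernoulli-suc : ∀ n → bernoulli (suc n) ≡
  - ((ℤ.+ 1 / suc (suc n)) * ∑[ j < suc n ] (⟦ suc (suc n) C j ⟧ * bernoulli j))
bernoulli-suc n = begin
  nth (bernoulliList n ++ [ Bₙ₊₁ ]) (suc n)
    ≡⟨ cong (nth (bernoulliList n ++ [ Bₙ₊₁ ])) (sym (length-bernoulliList n)) ⟩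
  nth (bernoulliList n ++ [ Bₙ₊₁ ]) (length (bernoulliList n))
    ≡⟨ nth-++-length (bernoulliList n) Bₙ₊₁ ⟩
  Bₙ₊₁
    ≡⟨ cong (λ s → - ((ℤ.+ 1 / suc (suc n)) * s)) (trans (sumIdx≡∑ (bernoulliList n) _) sum-eq) ⟩
  - ((ℤ.+ 1 / suc (suc n)) * ∑[ j < suc n ] (⟦ suc (suc n) C j ⟧ * bernoulli j)) ∎
  where
  open ≡-Reasoning
  Bₙ₊₁ = - ((ℤ.+ 1 / suc (suc n)) * sumIdx (bernoulliList n) (λ j b → ⟦ suc (suc n) C j ⟧ * b))
  sum-eq : ∑[ j < length (bernoulliList n) ] (⟦ suc (suc n) C j ⟧ * nth (bernoulliList n) j)
         ≡ ∑[ j < suc n ] (⟦ suc (suc n) C j ⟧ * bernoulli j)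
  sum-eq rewrite length-bernoulliList n = ∑-cong (suc n) (λ j j<1+n →
    cong (λ b → ⟦ suc (suc n) C j ⟧ * b) (nth-bernoulliList n j (ℕₚ.≤-pred j<1+n)))

[1+n]Cn≡1+n : ∀ n → suc n C n ≡ suc n
[1+n]Cn≡1+n n = trans (nCk≡nC[n∸k] (ℕₚ.n≤1+n n)) (trans (cong (suc n C_) (ℕₚ.m+n∸n≡m 1 n)) (nC1≡n (suc n)))

∑-binomial-bernoulli : ∀ m → ∑[ j < m ] (⟦ m C j ⟧ * bernoulli j) ≡ δ m 1
∑-binomial-bernoulli zero = refl
∑-binomial-bernoulli (suc zero) = refl
∑-binomial-bernoulli (suc (suc n)) = begin
  S + ⟦ M C suc n ⟧ * bernoulli (suc n)  ≡⟨ cong₂ (λ a b → S + ⟦ a ⟧ * b) ([1+n]Cn≡1+n (suc n)) (bernoulli-suc n) ⟩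
  S + ⟦ M ⟧ * (- (c * S))                ≡⟨ solve 3 (λ S a c → S :+ a :* (:- (c :* S)) := S :+ (:- ((a :* c) :* S))) refl S ⟦ M ⟧ c ⟩
  S + (- ((⟦ M ⟧ * c) * S))              ≡⟨ cong (λ z → S + (- (z * S))) (⟦1+n⟧*1/[1+n]≡1 (suc n)) ⟩
  S + (- (1ℚ * S))                       ≡⟨ cong (λ z → S + (- z)) (ℚₚ.*-identityˡ S) ⟩
  S + (- S)                              ≡⟨ ℚₚ.+-inverseʳ S ⟩
  0ℚ                                     ∎
  where
  open ≡-Reasoning
  M = suc (suc n)
  c = ℤ.+ 1 / M
  S = ∑[ j < suc n ] (⟦ M C j ⟧ * bernoulli j)

nCk*[k!*[n∸k]!]≡n! : ∀ n k → k ≤ n → (n C k) ℕ.* (k ! ℕ.* (n ∸ k) !) ≡ n !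
nCk*[k!*[n∸k]!]≡n! n k k≤n =
  trans (cong (ℕ._* (k ! ℕ.* (n ∸ k) !)) (nCk≡n!/k![n-k]! k≤n))
        (m/n*n≡m {{k ℕₚ.!* (n ∸ k) !≢0}} (k![n∸k]!∣n! k≤n))

[i+m]C[i+j]*[i+j]Ci≡[i+m]Ci*mCj : ∀ i m j → j ≤ m →
  ((i ℕ.+ m) C (i ℕ.+ j)) ℕ.* ((i ℕ.+ j) C i) ≡ ((i ℕ.+ m) C i) ℕ.* (m C j)
[i+m]C[i+j]*[i+j]Ci≡[i+m]Ci*mCj i m j j≤m =
  ℕₚ.*-cancelʳ-≡ _ _ (i ! ℕ.* j ! ℕ.* (m ∸ j) !) {{ℕₚ.m*n≢0 _ _ {{i ℕₚ.!* j !≢0}} {{(m ∸ j) ℕₚ.!≢0}}}}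
    (trans lhs (sym rhs))
  where
  open ≡-Reasoning
  A = (i ℕ.+ m) C (i ℕ.+ j)
  B = (i ℕ.+ j) C i
  C′ = (i ℕ.+ m) C i
  D = m C j
  factor-i+j : B ℕ.* (i ! ℕ.* j !) ≡ (i ℕ.+ j) !
  factor-i+j = subst (λ r → B ℕ.* (i ! ℕ.* r !) ≡ (i ℕ.+ j) !) (ℕₚ.m+n∸m≡n i j)
    (nCk*[k!*[n∸k]!]≡n! (i ℕ.+ j) i (ℕₚ.m≤m+n i j))
  factor-i+m : A ℕ.* ((i ℕ.+ j) ! ℕ.* (m ∸ j) !) ≡ (i ℕ.+ m) !
  factor-i+m = subst (λ r → A ℕ.* ((i ℕ.+ j) ! ℕ.* r !) ≡ (i ℕ.+ m) !) (ℕₚ.[m+n]∸[m+o]≡n∸o i m j)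
    (nCk*[k!*[n∸k]!]≡n! (i ℕ.+ m) (i ℕ.+ j) (ℕₚ.+-monoʳ-≤ i j≤m))
  factor-i : C′ ℕ.* (i ! ℕ.* m !) ≡ (i ℕ.+ m) !
  factor-i = subst (λ r → C′ ℕ.* (i ! ℕ.* r !) ≡ (i ℕ.+ m) !) (ℕₚ.m+n∸m≡n i m)
    (nCk*[k!*[n∸k]!]≡n! (i ℕ.+ m) i (ℕₚ.m≤m+n i m))
  lhs : A ℕ.* B ℕ.* (i ! ℕ.* j ! ℕ.* (m ∸ j) !) ≡ (i ℕ.+ m) !
  lhs = begin
    A ℕ.* B ℕ.* (i ! ℕ.* j ! ℕ.* (m ∸ j) !)
      ≡⟨ solveℕ 5 (λ a b x y z → a ⊛ b ⊛ (x ⊛ y ⊛ z) ⊜ a ⊛ (b ⊛ (x ⊛ y) ⊛ z)) refl A B (i !) (j !) ((m ∸ j) !) ⟩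
    A ℕ.* (B ℕ.* (i ! ℕ.* j !) ℕ.* (m ∸ j) !)
      ≡⟨ cong (λ r → A ℕ.* (r ℕ.* (m ∸ j) !)) factor-i+j ⟩
    A ℕ.* ((i ℕ.+ j) ! ℕ.* (m ∸ j) !)
      ≡⟨ factor-i+m ⟩
    (i ℕ.+ m) ! ∎
  rhs : C′ ℕ.* D ℕ.* (i ! ℕ.* j ! ℕ.* (m ∸ j) !) ≡ (i ℕ.+ m) !
  rhs = begin
    C′ ℕ.* D ℕ.* (i ! ℕ.* j ! ℕ.* (m ∸ j) !)
      ≡⟨ solveℕ 5 (λ c d x y z → c ⊛ d ⊛ (x ⊛ y ⊛ z) ⊜ c ⊛ (x ⊛ (d ⊛ (y ⊛ z)))) refl C′ D (i !) (j !) ((m ∸ j) !) ⟩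
    C′ ℕ.* (i ! ℕ.* (D ℕ.* (j ! ℕ.* (m ∸ j) !)))
      ≡⟨ cong (λ r → C′ ℕ.* (i ! ℕ.* r)) (nCk*[k!*[n∸k]!]≡n! m j j≤m) ⟩
    C′ ℕ.* (i ! ℕ.* m !)
      ≡⟨ factor-i ⟩
    (i ℕ.+ m) ! ∎

binomial-theorem : ∀ k x → (x + 1ℚ) ^ℚ k ≡ ∑[ i < suc k ] (⟦ k C i ⟧ * x ^ℚ i)
binomial-theorem zero x = refl
binomial-theorem (suc k) x = begin
  (x + 1ℚ) * (x + 1ℚ) ^ℚ k
    ≡⟨ cong ((x + 1ℚ) *_) (binomial-theorem k x) ⟩
  (x + 1ℚ) * ∑ (suc k) term
    ≡⟨ solve 2 (λ x S → (x :+ con 1ℚ) :* S := S :+ x :* S) refl x (∑ (suc k) term) ⟩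
  ∑ (suc k) term + x * ∑ (suc k) term
    ≡⟨ cong₂ _+_ lower upper ⟩
  (1ℚ + ∑ (suc k) shifted) + ∑ (suc k) raised
    ≡⟨ trans (ℚₚ.+-assoc 1ℚ (∑ (suc k) shifted) (∑ (suc k) raised)) (cong (1ℚ +_) (sym (∑-distrib-+ (suc k) shifted raised))) ⟩
  1ℚ + ∑[ i < suc k ] (shifted i + raised i)
    ≡⟨ cong (1ℚ +_) (∑-cong′ (suc k) pascal) ⟩
  1ℚ + ∑[ i < suc k ] (⟦ suc k C suc i ⟧ * x ^ℚ suc i)
    ≡⟨ sym (∑-suc (suc k) (λ i → ⟦ suc k C i ⟧ * x ^ℚ i)) ⟩
  ∑[ i < suc (suc k) ] (⟦ suc k C i ⟧ * x ^ℚ i) ∎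
  where
  open ≡-Reasoning
  term shifted raised : ℕ → ℚ
  term i = ⟦ k C i ⟧ * x ^ℚ i
  shifted i = ⟦ k C suc i ⟧ * x ^ℚ suc i
  raised i = ⟦ k C i ⟧ * x ^ℚ suc i
  lower : ∑ (suc k) term ≡ 1ℚ + ∑ (suc k) shifted
  lower = trans (∑-suc k term) (cong₂ _+_ (ℚₚ.*-identityˡ 1ℚ)
    (sym (∑-extend k (suc k) shifted (ℕₚ.n≤1+n k) (λ i k≤i →
      trans (cong (λ c → ⟦ c ⟧ * x ^ℚ suc i) (k>n⇒nCk≡0 (s≤s k≤i))) (ℚₚ.*-zeroˡ (x ^ℚ suc i))))))
  upper : x * ∑ (suc k) term ≡ ∑ (suc k) raised
  upper = trans (*-distribˡ-∑ (suc k) x term) (∑-cong′ (suc k) (λ i →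
    solve 3 (λ x c p → x :* (c :* p) := c :* (x :* p)) refl x ⟦ k C i ⟧ (x ^ℚ i)))
  pascal : ∀ i → shifted i + raised i ≡ ⟦ suc k C suc i ⟧ * x ^ℚ suc i
  pascal i = trans (sym (ℚₚ.*-distribʳ-+ (x ^ℚ suc i) ⟦ k C suc i ⟧ ⟦ k C i ⟧))
    (cong (_* x ^ℚ suc i) (trans (sym (⟦⟧-homo-+ (k C suc i) (k C i)))
      (cong ⟦_⟧ (trans (ℕₚ.+-comm (k C suc i) (k C i)) (nCk+nC[k+1]≡[n+1]C[k+1] k i)))))

binomial-theorem-extend : ∀ k x R → k < R → (x + 1ℚ) ^ℚ k ≡ ∑[ i < R ] (⟦ k C i ⟧ * x ^ℚ i)
binomial-theorem-extend k x R k<R = trans (binomial-theorem k x) (sym (∑-extend (suc k) R _ k<R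
  (λ i k<i → trans (cong (λ c → ⟦ c ⟧ * x ^ℚ i) (k>n⇒nCk≡0 k<i)) (ℚₚ.*-zeroˡ (x ^ℚ i)))))

𝔹-≤ : ∀ l u → u ≤ suc l → 𝔹 l u ≡ (ℤ.+ 1 / suc l) * (⟦ suc l C u ⟧ * bernoulli (suc l ∸ u))
𝔹-≤ l u u≤1+l with suc l ℕ.<ᵇ u in eq
... | false = refl
... | true = ⊥-elim (ℕₚ.<⇒≱ (ℕₚ.<ᵇ⇒< (suc l) u (subst T (sym eq) tt)) u≤1+l)

𝔹-> : ∀ l u → suc l < u → 𝔹 l u ≡ 0ℚ
𝔹-> l u 1+l<u with suc l ℕ.<ᵇ u in eq
... | true = refl
... | false = ⊥-elim (subst T eq (ℕₚ.<⇒<ᵇ 1+l<u))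

𝔹*binomial : ∀ l i m t → i ℕ.+ m ≡ suc l → suc t ≤ m →
  𝔹 l (i ℕ.+ suc t) * ⟦ (i ℕ.+ suc t) C i ⟧
    ≡ ((ℤ.+ 1 / suc l) * ⟦ suc l C i ⟧) * (⟦ m C suc t ⟧ * bernoulli (m ∸ suc t))
𝔹*binomial l i m t i+m≡1+l 1+t≤m = begin
  𝔹 l k * ⟦ k C i ⟧
    ≡⟨ cong (_* ⟦ k C i ⟧) (𝔹-≤ l k k≤1+l) ⟩
  c * (⟦ suc l C k ⟧ * bernoulli (suc l ∸ k)) * ⟦ k C i ⟧
    ≡⟨ solve 4 (λ c x b y → c :* (x :* b) :* y := c :* (x :* y) :* b) refl c ⟦ suc l C k ⟧ (bernoulli (suc l ∸ k)) ⟦ k C i ⟧ ⟩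
  c * (⟦ suc l C k ⟧ * ⟦ k C i ⟧) * bernoulli (suc l ∸ k)
    ≡⟨ cong₂ (λ p r → c * p * bernoulli r) binomials (subst (λ L → L ∸ k ≡ m ∸ suc t) i+m≡1+l (ℕₚ.[m+n]∸[m+o]≡n∸o i m (suc t))) ⟩
  c * (⟦ suc l C i ⟧ * ⟦ m C suc t ⟧) * bernoulli (m ∸ suc t)
    ≡⟨ solve 4 (λ c x y b → c :* (x :* y) :* b := c :* x :* (y :* b)) refl c ⟦ suc l C i ⟧ ⟦ m C suc t ⟧ (bernoulli (m ∸ suc t)) ⟩
  c * ⟦ suc l C i ⟧ * (⟦ m C suc t ⟧ * bernoulli (m ∸ suc t)) ∎
  where
  open ≡-Reasoning
  k = i ℕ.+ suc t
  c = ℤ.+ 1 / suc l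
  k≤1+l : k ≤ suc l
  k≤1+l = subst (k ≤_) i+m≡1+l (ℕₚ.+-monoʳ-≤ i 1+t≤m)
  binomials : ⟦ suc l C k ⟧ * ⟦ k C i ⟧ ≡ ⟦ suc l C i ⟧ * ⟦ m C suc t ⟧
  binomials = begin
    ⟦ suc l C k ⟧ * ⟦ k C i ⟧        ≡⟨ sym (⟦⟧-homo-* (suc l C k) (k C i)) ⟩
    ⟦ (suc l C k) ℕ.* (k C i) ⟧      ≡⟨ cong ⟦_⟧ (subst (λ L → (L C k) ℕ.* (k C i) ≡ (L C i) ℕ.* (m C suc t)) i+m≡1+l
                                          ([i+m]C[i+j]*[i+j]Ci≡[i+m]Ci*mCj i m (suc t) 1+t≤m)) ⟩
    ⟦ (suc l C i) ℕ.* (m C suc t) ⟧  ≡⟨ ⟦⟧-homo-* (suc l C i) (m C suc t) ⟩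
    ⟦ suc l C i ⟧ * ⟦ m C suc t ⟧    ∎

∑-binomial-bernoulli-reversed : ∀ m → ∑[ t < m ] (⟦ m C suc t ⟧ * bernoulli (m ∸ suc t)) ≡ δ m 1
∑-binomial-bernoulli-reversed m = begin
  ∑[ t < m ] h t                        ≡⟨ ∑-reverse m h ⟩
  ∑[ j < m ] h (m ∸ suc j)              ≡⟨ ∑-cong m reindex ⟩
  ∑[ j < m ] (⟦ m C j ⟧ * bernoulli j)  ≡⟨ ∑-binomial-bernoulli m ⟩
  δ m 1                                 ∎
  where
  open ≡-Reasoning
  h : ℕ → ℚ
  h t = ⟦ m C suc t ⟧ * bernoulli (m ∸ suc t)
  reindex : ∀ j → j < m → h (m ∸ suc j) ≡ ⟦ m C j ⟧ * bernoulli j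
  reindex j j<m = cong₂ (λ u v → ⟦ u ⟧ * bernoulli v)
    (trans (cong (m C_) (sym m∸j≡1+[m∸1+j])) (sym (nCk≡nC[n∸k] (ℕₚ.<⇒≤ j<m))))
    (trans (cong (m ∸_) (sym m∸j≡1+[m∸1+j])) (ℕₚ.m∸[m∸n]≡n (ℕₚ.<⇒≤ j<m)))
    where
    m∸j≡1+[m∸1+j] : m ∸ j ≡ suc (m ∸ suc j)
    m∸j≡1+[m∸1+j] = ℕₚ.+-∸-assoc 1 j<m

1/[1+l]*[1+l]Ci*δm1≡δil : ∀ l i m → i ℕ.+ m ≡ suc l → ((ℤ.+ 1 / suc l) * ⟦ suc l C i ⟧) * δ m 1 ≡ δ i l
1/[1+l]*[1+l]Ci*δm1≡δil l i m i+m≡1+l with i ℕ.≟ l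
... | yes refl = begin
  (c * ⟦ suc i C i ⟧) * δ m 1   ≡⟨ cong₂ (λ b d → (c * ⟦ b ⟧) * d) ([1+n]Cn≡1+n i) (trans (cong (λ n → δ n 1) m≡1) (δ-refl 1)) ⟩
  (c * ⟦ suc i ⟧) * 1ℚ          ≡⟨ ℚₚ.*-identityʳ _ ⟩
  c * ⟦ suc i ⟧                 ≡⟨ trans (ℚₚ.*-comm c ⟦ suc i ⟧) (⟦1+n⟧*1/[1+n]≡1 i) ⟩
  1ℚ                            ∎
  where
  open ≡-Reasoning
  c = ℤ.+ 1 / suc i
  m≡1 : m ≡ 1
  m≡1 = ℕₚ.+-cancelˡ-≡ i m 1 (trans i+m≡1+l (ℕₚ.+-comm 1 i))
... | no i≢l = trans (cong (K *_) (δ-≢ m≢1)) (ℚₚ.*-zeroʳ K)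
  where
  K = (ℤ.+ 1 / suc l) * ⟦ suc l C i ⟧
  m≢1 : m ≢ 1
  m≢1 refl = i≢l (ℕₚ.suc-injective (trans (ℕₚ.+-comm 1 i) i+m≡1+l))

-- The constant term 𝔹 l 0 is replaced by 0: the power sums vanish at N = 0.
faulhaberCoef : ℕ → ℕ → ℚ
faulhaberCoef l zero = 0ℚ
faulhaberCoef l (suc k) = 𝔹 l (suc k)

faulhaber : ℕ → ℚ → ℚ
faulhaber l x = ∑[ k < suc (suc l) ] (faulhaberCoef l k * x ^ℚ k)

∑-faulhaberCoef*binomial : ∀ l i m → i ℕ.+ m ≡ suc l →
  ∑[ k < suc (suc l) ] (faulhaberCoef l k * ⟦ k C i ⟧) ≡ faulhaberCoef l i + δ i l
∑-faulhaberCoef*binomial l i m i+m≡1+l = begin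
  ∑ (suc (suc l)) F                                   ≡⟨ cong (λ n → ∑ n F) (sym i+[1+m]≡2+l) ⟩
  ∑ (i ℕ.+ suc m) F                                   ≡⟨ ∑-split i (suc m) F ⟩
  ∑ i F + ∑[ t < suc m ] F (i ℕ.+ t)                  ≡⟨ cong₂ _+_ (∑≡0 i below) (∑-suc m (λ t → F (i ℕ.+ t))) ⟩
  0ℚ + (F (i ℕ.+ 0) + ∑[ t < m ] F (i ℕ.+ suc t))     ≡⟨ cong₂ (λ u v → 0ℚ + (u + v)) diagonal (∑-cong m above) ⟩
  0ℚ + (faulhaberCoef l i + ∑[ t < m ] (K * h t))     ≡⟨ ℚₚ.+-identityˡ _ ⟩
  faulhaberCoef l i + ∑[ t < m ] (K * h t)            ≡⟨ cong (faulhaberCoef l i +_) (sym (*-distribˡ-∑ m K h)) ⟩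
  faulhaberCoef l i + K * ∑ m h                       ≡⟨ cong (λ s → faulhaberCoef l i + K * s) (∑-binomial-bernoulli-reversed m) ⟩
  faulhaberCoef l i + K * δ m 1                       ≡⟨ cong (faulhaberCoef l i +_) (1/[1+l]*[1+l]Ci*δm1≡δil l i m i+m≡1+l) ⟩
  faulhaberCoef l i + δ i l                           ∎
  where
  open ≡-Reasoning
  F : ℕ → ℚ
  F k = faulhaberCoef l k * ⟦ k C i ⟧
  K = (ℤ.+ 1 / suc l) * ⟦ suc l C i ⟧
  h : ℕ → ℚ
  h t = ⟦ m C suc t ⟧ * bernoulli (m ∸ suc t)
  i+[1+m]≡2+l : i ℕ.+ suc m ≡ suc (suc l)
  i+[1+m]≡2+l = trans (ℕₚ.+-suc i m) (cong suc i+m≡1+l)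
  below : ∀ k → k < i → F k ≡ 0ℚ
  below k k<i = trans (cong (λ c → faulhaberCoef l k * ⟦ c ⟧) (k>n⇒nCk≡0 k<i)) (ℚₚ.*-zeroʳ (faulhaberCoef l k))
  diagonal : F (i ℕ.+ 0) ≡ faulhaberCoef l i
  diagonal rewrite ℕₚ.+-identityʳ i | nCn≡1 i = ℚₚ.*-identityʳ (faulhaberCoef l i)
  above : ∀ t → t < m → F (i ℕ.+ suc t) ≡ K * h t
  above t t<m = trans (cong (_* ⟦ (i ℕ.+ suc t) C i ⟧) coef) (𝔹*binomial l i m t i+m≡1+l t<m)
    where
    coef : faulhaberCoef l (i ℕ.+ suc t) ≡ 𝔹 l (i ℕ.+ suc t)
    coef rewrite ℕₚ.+-suc i t = refl

faulhaber-shift : ∀ l x → faulhaber l (x + 1ℚ) ≡ faulhaber l x + x ^ℚ l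
faulhaber-shift l x = begin
  ∑[ k < M ] (a k * (x + 1ℚ) ^ℚ k)
    ≡⟨ ∑-cong M (λ k k<M → cong (a k *_) (binomial-theorem-extend k x M k<M)) ⟩
  ∑[ k < M ] (a k * ∑[ i < M ] (⟦ k C i ⟧ * x ^ℚ i))
    ≡⟨ ∑-cong′ M (λ k → *-distribˡ-∑ M (a k) _) ⟩
  ∑[ k < M ] ∑[ i < M ] (a k * (⟦ k C i ⟧ * x ^ℚ i))
    ≡⟨ ∑-comm M M _ ⟩
  ∑[ i < M ] ∑[ k < M ] (a k * (⟦ k C i ⟧ * x ^ℚ i))
    ≡⟨ ∑-cong′ M (λ i → trans (∑-cong′ M (λ k → sym (ℚₚ.*-assoc (a k) ⟦ k C i ⟧ (x ^ℚ i))))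
                               (sym (*-distribʳ-∑ M (x ^ℚ i) (λ k → a k * ⟦ k C i ⟧)))) ⟩
  ∑[ i < M ] (∑[ k < M ] (a k * ⟦ k C i ⟧) * x ^ℚ i)
    ≡⟨ ∑-cong M (λ i i<M → cong (_* x ^ℚ i)
         (∑-faulhaberCoef*binomial l i (suc l ∸ i) (ℕₚ.m+[n∸m]≡n (ℕₚ.≤-pred i<M)))) ⟩
  ∑[ i < M ] ((a i + δ i l) * x ^ℚ i)
    ≡⟨ trans (∑-cong′ M (λ i → ℚₚ.*-distribʳ-+ (x ^ℚ i) (a i) (δ i l))) (∑-distrib-+ M _ _) ⟩
  faulhaber l x + ∑[ i < M ] (δ i l * x ^ℚ i)
    ≡⟨ cong (faulhaber l x +_) (∑-δ M l (x ^ℚ_) (ℕₚ.≤-trans (ℕₚ.n<1+n l) (ℕₚ.n≤1+n _))) ⟩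
  faulhaber l x + x ^ℚ l ∎
  where
  open ≡-Reasoning
  M = suc (suc l)
  a = faulhaberCoef l

faulhaber-0 : ∀ l → faulhaber l 0ℚ ≡ 0ℚ
faulhaber-0 l = ∑≡0 (suc (suc l)) λ where
  zero _ → ℚₚ.*-zeroˡ 1ℚ
  (suc k) _ → trans (cong (𝔹 l (suc k) *_) (ℚₚ.*-zeroˡ (0ℚ ^ℚ k))) (ℚₚ.*-zeroʳ (𝔹 l (suc k)))

∑-power≡faulhaber : ∀ l N → ∑[ n < N ] (⟦ n ⟧ ^ℚ l) ≡ faulhaber l ⟦ N ⟧
∑-power≡faulhaber l zero = sym (faulhaber-0 l)
∑-power≡faulhaber l (suc N) = begin
  ∑[ n < N ] (⟦ n ⟧ ^ℚ l) + ⟦ N ⟧ ^ℚ l   ≡⟨ cong (_+ ⟦ N ⟧ ^ℚ l) (∑-power≡faulhaber l N) ⟩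
  faulhaber l ⟦ N ⟧ + ⟦ N ⟧ ^ℚ l       ≡⟨ sym (faulhaber-shift l ⟦ N ⟧) ⟩
  faulhaber l (⟦ N ⟧ + 1ℚ)             ≡⟨ cong (faulhaber l) (sym (trans (cong ⟦_⟧ (ℕₚ.+-comm 1 N)) (⟦⟧-homo-+ N 1))) ⟩
  faulhaber l ⟦ suc N ⟧                ∎
  where open ≡-Reasoning

∑-power : ∀ l N R → suc l ≤ R → ∑[ n < N ] (⟦ n ⟧ ^ℚ l) ≡ ∑[ k < R ] (𝔹 l (suc k) * ⟦ N ⟧ ^ℚ suc k)
∑-power l N R 1+l≤R = begin
  ∑[ n < N ] (⟦ n ⟧ ^ℚ l)                                  ≡⟨ ∑-power≡faulhaber l N ⟩
  faulhaber l ⟦ N ⟧                                      ≡⟨ ∑-suc (suc l) _ ⟩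
  0ℚ * 1ℚ + ∑[ k < suc l ] (𝔹 l (suc k) * x ^ℚ suc k)    ≡⟨ trans (cong (_+ S) (ℚₚ.*-zeroˡ 1ℚ)) (ℚₚ.+-identityˡ S) ⟩
  ∑[ k < suc l ] (𝔹 l (suc k) * x ^ℚ suc k)              ≡⟨ sym (∑-extend (suc l) R _ 1+l≤R vanish) ⟩
  ∑[ k < R ] (𝔹 l (suc k) * x ^ℚ suc k)                  ∎
  where
  open ≡-Reasoning
  x = ⟦ N ⟧
  S = ∑[ k < suc l ] (𝔹 l (suc k) * x ^ℚ suc k)
  vanish : ∀ k → suc l ≤ k → 𝔹 l (suc k) * x ^ℚ suc k ≡ 0ℚ
  vanish k 1+l≤k = trans (cong (_* x ^ℚ suc k) (𝔹-> l (suc k) (s≤s 1+l≤k))) (ℚₚ.*-zeroˡ (x ^ℚ suc k))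

⟦Hfrom-∷⟧ : ∀ {d} m N l (ls : Vec ℕ d) →
  ⟦ Hfrom m N (l ∷ ls) ⟧ ≡ ∑range m N (λ n → ⟦ n ⟧ ^ℚ l * ⟦ Hfrom (suc n) N ls ⟧)
⟦Hfrom-∷⟧ m N l ls = trans (⟦ΣℕRange⟧ m N _) (∑-cong′ (N ∸ m) (λ i →
  trans (⟦⟧-homo-* ((m ℕ.+ i) ℕ.^ l) (Hfrom (suc (m ℕ.+ i)) N ls))
        (cong (_* ⟦ Hfrom (suc (m ℕ.+ i)) N ls ⟧) (⟦⟧-homo-^ (m ℕ.+ i) l))))

∑-triangle-comm : ∀ N (f g : ℕ → ℚ) → ∑[ a < N ] (f a * ∑range (suc a) N g) ≡ ∑[ b < N ] (∑ b f * g b)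
∑-triangle-comm zero f g = refl
∑-triangle-comm (suc N) f g = begin
  ∑[ a < N ] (f a * ∑range (suc a) (suc N) g) + f N * ∑range (suc N) (suc N) g
    ≡⟨ cong₂ _+_ (∑-cong N (λ a a<N → cong (f a *_) (∑range-snoc (suc a) N g a<N)))
                 (trans (cong (f N *_) (∑range-empty (suc N) g)) (ℚₚ.*-zeroʳ (f N))) ⟩
  ∑[ a < N ] (f a * (∑range (suc a) N g + g N)) + 0ℚ
    ≡⟨ trans (ℚₚ.+-identityʳ _) (∑-cong′ N (λ a → ℚₚ.*-distribˡ-+ (f a) _ _)) ⟩
  ∑[ a < N ] (f a * ∑range (suc a) N g + f a * g N)
    ≡⟨ ∑-distrib-+ N _ _ ⟩
  ∑[ a < N ] (f a * ∑range (suc a) N g) + ∑[ a < N ] (f a * g N)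
    ≡⟨ cong₂ _+_ (∑-triangle-comm N f g) (sym (*-distribʳ-∑ N (g N) f)) ⟩
  ∑[ b < N ] (∑ b f * g b) + ∑ N f * g N ∎
  where open ≡-Reasoning

Hfrom-peel : ∀ {d} A l (ls : Vec ℕ d) N →
  ⟦ Hfrom 0 N (A ∷ l ∷ ls) ⟧ ≡ ∑[ i < suc A ] (𝔹 A (suc i) * ⟦ Hfrom 0 N ((suc i ℕ.+ l) ∷ ls) ⟧)
Hfrom-peel A l ls N = begin
  ⟦ Hfrom 0 N (A ∷ l ∷ ls) ⟧
    ≡⟨ ⟦Hfrom-∷⟧ 0 N A (l ∷ ls) ⟩
  ∑[ n₁ < N ] (⟦ n₁ ⟧ ^ℚ A * ⟦ Hfrom (suc n₁) N (l ∷ ls) ⟧)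
    ≡⟨ ∑-cong′ N (λ n₁ → cong (⟦ n₁ ⟧ ^ℚ A *_) (⟦Hfrom-∷⟧ (suc n₁) N l ls)) ⟩
  ∑[ n₁ < N ] (⟦ n₁ ⟧ ^ℚ A * ∑range (suc n₁) N w)
    ≡⟨ ∑-triangle-comm N (λ n → ⟦ n ⟧ ^ℚ A) w ⟩
  ∑[ n₂ < N ] (∑[ n₁ < n₂ ] (⟦ n₁ ⟧ ^ℚ A) * w n₂)
    ≡⟨ ∑-cong′ N (λ n₂ → cong (_* w n₂) (∑-power A n₂ (suc A) ℕₚ.≤-refl)) ⟩
  ∑[ n₂ < N ] (∑[ i < suc A ] (𝔹 A (suc i) * ⟦ n₂ ⟧ ^ℚ suc i) * w n₂)
    ≡⟨ ∑-cong′ N (λ n₂ → trans (*-distribʳ-∑ (suc A) (w n₂) _) (∑-cong′ (suc A) (merge n₂))) ⟩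
  ∑[ n₂ < N ] ∑[ i < suc A ] (𝔹 A (suc i) * (⟦ n₂ ⟧ ^ℚ (suc i ℕ.+ l) * h n₂))
    ≡⟨ ∑-comm N (suc A) _ ⟩
  ∑[ i < suc A ] ∑[ n₂ < N ] (𝔹 A (suc i) * (⟦ n₂ ⟧ ^ℚ (suc i ℕ.+ l) * h n₂))
    ≡⟨ ∑-cong′ (suc A) (λ i → sym (*-distribˡ-∑ N (𝔹 A (suc i)) _)) ⟩
  ∑[ i < suc A ] (𝔹 A (suc i) * ∑[ n₂ < N ] (⟦ n₂ ⟧ ^ℚ (suc i ℕ.+ l) * h n₂))
    ≡⟨ ∑-cong′ (suc A) (λ i → cong (𝔹 A (suc i) *_) (sym (⟦Hfrom-∷⟧ 0 N (suc i ℕ.+ l) ls))) ⟩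
  ∑[ i < suc A ] (𝔹 A (suc i) * ⟦ Hfrom 0 N ((suc i ℕ.+ l) ∷ ls) ⟧) ∎
  where
  open ≡-Reasoning
  h w : ℕ → ℚ
  h n = ⟦ Hfrom (suc n) N ls ⟧
  w n = ⟦ n ⟧ ^ℚ l * h n
  merge : ∀ n i → 𝔹 A (suc i) * ⟦ n ⟧ ^ℚ suc i * w n ≡ 𝔹 A (suc i) * (⟦ n ⟧ ^ℚ (suc i ℕ.+ l) * h n)
  merge n i = trans
    (solve 4 (λ b p q r → b :* p :* (q :* r) := b :* (p :* q :* r)) refl (𝔹 A (suc i)) (⟦ n ⟧ ^ℚ suc i) (⟦ n ⟧ ^ℚ l) (h n))
    (cong (λ p → 𝔹 A (suc i) * (p * h n)) (sym (^ℚ-distribˡ-+-* ⟦ n ⟧ (suc i) l)))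

peel-degree : ∀ i A l s d → i ≤ A → suc (suc i ℕ.+ l ℕ.+ (s ℕ.+ d)) ≤ suc (A ℕ.+ (l ℕ.+ s ℕ.+ suc d))
peel-degree i A l s d i≤A = subst₂ _≤_ (lhs i) rhs (ℕₚ.+-monoˡ-≤ (suc (suc (l ℕ.+ (s ℕ.+ d)))) i≤A)
  where
  lhs : ∀ j → j ℕ.+ suc (suc (l ℕ.+ (s ℕ.+ d))) ≡ suc (suc j ℕ.+ l ℕ.+ (s ℕ.+ d))
  lhs j = solveℕ 4 (λ j l s d → j ⊕ (conℕ 2 ⊕ (l ⊕ (s ⊕ d))) ⊜ conℕ 2 ⊕ j ⊕ l ⊕ (s ⊕ d)) refl j l s d
  rhs : A ℕ.+ suc (suc (l ℕ.+ (s ℕ.+ d))) ≡ suc (A ℕ.+ (l ℕ.+ s ℕ.+ suc d))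
  rhs = solveℕ 4 (λ a l s d → a ⊕ (conℕ 2 ⊕ (l ⊕ (s ⊕ d))) ⊜ conℕ 1 ⊕ (a ⊕ (l ⊕ s ⊕ (conℕ 1 ⊕ d)))) refl A l s d

Hfrom-expansion : ∀ {d} (ls : Vec ℕ d) kp l N R → suc (kp ℕ.+ l ℕ.+ (sum ls ℕ.+ d)) ≤ R →
  ⟦ Hfrom 0 N ((kp ℕ.+ l) ∷ ls) ⟧ ≡ ∑[ j < R ] (nestedCoef kp (l ∷ ls) (suc j) * ⟦ N ⟧ ^ℚ suc j)
Hfrom-expansion [] kp l N R deg≤R = begin
  ⟦ Hfrom 0 N (A ∷ []) ⟧                            ≡⟨ ⟦Hfrom-∷⟧ 0 N A [] ⟩
  ∑[ n < N ] (⟦ n ⟧ ^ℚ A * 1ℚ)                      ≡⟨ ∑-cong′ N (λ n → ℚₚ.*-identityʳ _) ⟩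
  ∑[ n < N ] (⟦ n ⟧ ^ℚ A)                           ≡⟨ ∑-power A N R (subst (λ D → suc D ≤ R) (ℕₚ.+-identityʳ A) deg≤R) ⟩
  ∑[ j < R ] (𝔹 A (suc j) * ⟦ N ⟧ ^ℚ suc j)         ∎
  where
  open ≡-Reasoning
  A = kp ℕ.+ l
Hfrom-expansion (l′ ∷ ls) kp l N R deg≤R = begin
  ⟦ Hfrom 0 N (A ∷ l′ ∷ ls) ⟧
    ≡⟨ Hfrom-peel A l′ ls N ⟩
  ∑[ i < suc A ] (𝔹 A (suc i) * ⟦ Hfrom 0 N ((suc i ℕ.+ l′) ∷ ls) ⟧)
    ≡⟨ ∑-cong (suc A) (λ i i<1+A → cong (𝔹 A (suc i) *_) (Hfrom-expansion ls (suc i) l′ N R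
         (ℕₚ.≤-trans (peel-degree i A l′ (sum ls) _ (ℕₚ.≤-pred i<1+A)) deg≤R))) ⟩
  ∑[ i < suc A ] (𝔹 A (suc i) * ∑[ j < R ] (c i j * x ^ℚ suc j))
    ≡⟨ ∑-cong′ (suc A) (λ i → *-distribˡ-∑ R (𝔹 A (suc i)) _) ⟩
  ∑[ i < suc A ] ∑[ j < R ] (𝔹 A (suc i) * (c i j * x ^ℚ suc j))
    ≡⟨ ∑-comm (suc A) R _ ⟩
  ∑[ j < R ] ∑[ i < suc A ] (𝔹 A (suc i) * (c i j * x ^ℚ suc j))
    ≡⟨ ∑-cong′ R (λ j → trans (∑-cong′ (suc A) (λ i → sym (ℚₚ.*-assoc (𝔹 A (suc i)) (c i j) (x ^ℚ suc j))))
                              (sym (*-distribʳ-∑ (suc A) (x ^ℚ suc j) _))) ⟩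
  ∑[ j < R ] (∑[ i < suc A ] (𝔹 A (suc i) * c i j) * x ^ℚ suc j)
    ≡⟨ ∑-cong′ R (λ j → cong (_* x ^ℚ suc j) (sym (nestedCoef-∷ j))) ⟩
  ∑[ j < R ] (nestedCoef kp (l ∷ l′ ∷ ls) (suc j) * x ^ℚ suc j) ∎
  where
  open ≡-Reasoning
  A = kp ℕ.+ l
  x = ⟦ N ⟧
  c : ℕ → ℕ → ℚ
  c i j = nestedCoef (suc i) (l′ ∷ ls) (suc j)
  nestedCoef-∷ : ∀ j → nestedCoef kp (l ∷ l′ ∷ ls) (suc j) ≡ ∑[ i < suc A ] (𝔹 A (suc i) * c i j)
  nestedCoef-∷ j = trans (Σ[⋯]≡∑ 1 (A ℕ.+ 1) _) (cong (λ n → ∑[ i < n ] (𝔹 A (suc i) * c i j)) (ℕₚ.+-comm A 1))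

corollary4p4 : (d : ℕ) → 1 ≤ d → (ls : Vec ℕ d) → All (1 ≤_) ls →
    (N : ℕ) → 1 ≤ N →
    ⟦ Htilde N ls ⟧ ≡ Σ[ 1 ⋯ sum ls ℕ.+ d ] (λ k → 𝔹multi ls k * (⟦ N ⟧ ^ℚ k))
corollary4p4 zero () ls _ N _
corollary4p4 (suc d) _ (l ∷ ls) _ N _ =
  trans (Hfrom-expansion ls 0 l N D (ℕₚ.≤-reflexive degree)) (sym (Σ[⋯]≡∑ 1 D _))
  where
  D = l ℕ.+ sum ls ℕ.+ suc d
  degree : suc (l ℕ.+ (sum ls ℕ.+ d)) ≡ D
  degree = solveℕ 3 (λ l s d → conℕ 1 ⊕ (l ⊕ (s ⊕ d)) ⊜ l ⊕ s ⊕ (conℕ 1 ⊕ d)) refl l (sum ls) d
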